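{- For any $f\colon\{0,1\}^n\to\{0,1\}$ it holds that $\mathrm{Amb}(f)\ge\frac{K(f)}{4}$.
   Context: For $A\subseteq f^{ -1}(1)$, $B\subseteq f^{ -1}(0)$, $E(A,B)$ is the set of pairs $(a,b)\in A\times B$ differing in exactly one coordinate, and $K(f)=\max_{A,B}\frac{|E(A,B)|^2}{|A|\cdot|B|}$ over nonempty $A\subseteq f^{ -1}(1)$, $B\subseteq f^{ -1}(0)$. For $R\subseteq f^{ -1}(1)\times f^{ -1}(0)$ with projections $A,B$ to the first and second coordinates, let $R(a,B)=\{b\in B:(a,b)\in R\}$, $R_i(a,B)=\{b\in B:(a,b)\in R,a_i\ne b_i\}$, and define $R(A,b),R_i(A,b)$ analogously. The unweighted quantum adversary bound is \[\mathrm{Amb}(f)=\max_{R}\frac{\min_{a\in A}|R(a,B)|\cdot\min_{b\in B}|R(A,b)|}{\max_{a\in A,i\in[n]}|R_i(a,B)|\cdot\max_{b\in B,i\in[n]}|R_i(A,b)|}.\] -}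

module Defs where

open import Data.Bool using (Bool; true; false; _∧_; not)
open import Data.Bool.Properties using () renaming (_≟_ to _≟ᵇ_)
open import Data.Nat using (ℕ; zero; suc; _≤_; _*_; _⊓_; _⊔_)
open import Data.Fin using (Fin)
open import Data.Vec using (Vec; lookup)
open import Data.Vec.Properties using (≡-dec)
open import Data.List using (List; []; _∷_; length; filter; foldr; map; cartesianProduct; allFin; concatMap)
open import Data.Product using (_×_; _,_; proj₁; proj₂)
open import Relation.Nullary using (Dec; yes; no; ¬_)
open import Relation.Nullary.Decidable using (_×-dec_; ¬?)
open import Relation.Binary.PropositionalEquality using (_≡_)
import Data.Nat as ℕ

Point : ℕ → Set
Point n = Vec Bool n

_≟ₚ_ : ∀ {n} (x y : Point n) → Dec (x ≡ y)
_≟ₚ_ = ≡-dec _≟ᵇ_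

hamming : ∀ {n} → Point n → Point n → ℕ
hamming {n} x y = length (filter (λ i → ¬? (lookup x i ≟ᵇ lookup y i)) (allFin n))

adjacent? : ∀ {n} (x y : Point n) → Dec (hamming x y ≡ 1)
adjacent? x y = hamming x y ℕ.≟ 1

-- |E(A,B)| for finite sets A, B given as duplicate-free lists
edgeCount : ∀ {n} → List (Point n) → List (Point n) → ℕ
edgeCount A B = length (filter (λ p → adjacent? (proj₁ p) (proj₂ p)) (cartesianProduct A B))

-- a relation R ⊆ f⁻¹(1) × f⁻¹(0), as a duplicate-free list of pairs
Rel : ℕ → Set
Rel n = List (Point n × Point n)

degL : ∀ {n} → Rel n → Point n → ℕ
degL R a = length (filter (λ p → proj₁ p ≟ₚ a) R)

degR : ∀ {n} → Rel n → Point n → ℕ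
degR R b = length (filter (λ p → proj₂ p ≟ₚ b) R)

degLᵢ : ∀ {n} → Rel n → Point n → Fin n → ℕ
degLᵢ R a i = length (filter (λ p → (proj₁ p ≟ₚ a) ×-dec ¬? (lookup (proj₁ p) i ≟ᵇ lookup (proj₂ p) i)) R)

degRᵢ : ∀ {n} → Rel n → Point n → Fin n → ℕ
degRᵢ R b i = length (filter (λ p → (proj₂ p ≟ₚ b) ×-dec ¬? (lookup (proj₁ p) i ≟ᵇ lookup (proj₂ p) i)) R)

-- minimum of g over a nonempty list (0 on the empty list; only used for nonempty lists)
minOver : ∀ {A : Set} → (A → ℕ) → List A → ℕ
minOver g [] = 0
minOver g (x ∷ xs) = foldr (λ y m → g y ⊓ m) (g x) xs

maxOver : ∀ {A : Set} → (A → ℕ) → List A → ℕ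
maxOver g xs = foldr (λ y m → g y ⊔ m) 0 xs

-- The projection A of R is exactly the set of first coordinates of pairs of R,
-- so min_{a ∈ A} |R(a,B)| = min over pairs p ∈ R of |R(p₁,B)|, etc.
minDegL minDegR : ∀ {n} → Rel n → ℕ
minDegL R = minOver (λ p → degL R (proj₁ p)) R
minDegR R = minOver (λ p → degR R (proj₂ p)) R

maxDegLᵢ maxDegRᵢ : ∀ {n} → Rel n → ℕ
maxDegLᵢ {n} R = maxOver (λ p → maxOver (λ i → degLᵢ R (proj₁ p) i) (allFin n)) R
maxDegRᵢ {n} R = maxOver (λ p → maxOver (λ i → degRᵢ R (proj₂ p) i) (allFin n)) R

-- Peel the bipartite graph E(A,B): with E = |E(A,B)|, repeatedly delete a vertex of A with fewer
-- than E/(2|A|) neighbours or a vertex of B with fewer than E/(2|B|) neighbours. The potential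
-- E|B|·|A′| + E|A|·|B′| ≤ 2|A||B|·|E(A′,B′)| holds with equality at the start and becomes strict
-- after any deletion, so the process stops at a core with at least one edge in which all these
-- degree bounds hold. Let R be the edge set of the core. Two points that differ from a third one
-- exactly in the same coordinate i are equal, so |R_i(a,B)| ≤ 1 and |R_i(A,b)| ≤ 1, while
-- min |R(a,B)| · min |R(A,b)| ≥ E²/(4|A||B|). If E = 0, any single pair of A × B will do.

module Submission where

open import Defs
open import Data.Bool using (Bool; true; false)
open import Data.Nat using (ℕ; _≤_; _*_)
open import Data.List using (List; []; length)
open import Data.List.Relation.Unary.All using (All)
open import Data.List.Relation.Unary.Unique.Propositional using (Unique)
open import Data.Product using (_×_; Σ; proj₁; proj₂)
open import Relation.Binary.PropositionalEquality using (_≡_; _≢_)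

open import Data.Bool.Properties using (¬-not) renaming (_≟_ to _≟ᵇ_)
open import Data.Fin using (Fin) renaming (_≟_ to _≟ᶠ_)
open import Data.List using (_∷_; [_]; _++_; filter; map; cartesianProduct; allFin)
open import Data.List.Properties using (filter-++; length-++; length-map; length-++-sucʳ; filter-all; cartesianProductWith-distribʳ-++)
open import Data.List.Membership.Propositional using (_∈_; find)
open import Data.List.Membership.Propositional.Properties using (∈-∃++; ∈-filter⁺; ∈-filter⁻; ∈-allFin; ∈-cartesianProduct⁻)
open import Data.List.Relation.Binary.Sublist.Propositional using (_⊆_; []; _∷_; _∷ʳ_; ⊆-refl; ⊆-trans; from∈)
open import Data.List.Relation.Binary.Sublist.Propositional.Properties using (All-resp-⊆; filter⁺; filter-⊆; map⁺; ++⁺; ++⁺ˡ; ++⁺ʳ; length-mono-≤)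
open import Data.List.Relation.Unary.All using ([]; _∷_; all?)
import Data.List.Relation.Unary.All as All
open import Data.List.Relation.Unary.All.Properties using (¬All⇒Any¬; all-filter)
import Data.List.Relation.Unary.All.Properties as Allₚ
open import Data.List.Relation.Unary.AllPairs using ([]; _∷_)
open import Data.List.Relation.Unary.Any using (Any; here; there)
import Data.List.Relation.Unary.Any as Any
import Data.List.Relation.Unary.Unique.Propositional.Properties as Unique
open import Data.Nat using (zero; suc; _+_; _<_; z≤n; s≤s; z<s; _≤?_; _<?_; >-nonZero)
open import Data.Nat.Induction using (<-wellFounded)
open import Data.Nat.Properties
open import Algebra.Properties.CommutativeSemigroup +-commutativeSemigroup using (interchange; x∙yz≈y∙xz)
open import Data.Nat.Tactic.RingSolver using (solve-∀)
open import Data.Product using (_,_; ∃; ∃₂)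
open import Data.Sum using (inj₁; inj₂)
open import Data.Vec using (lookup)
open import Data.Vec.Relation.Binary.Pointwise.Extensional using (ext; Pointwise-≡⇒≡)
open import Function using (_∘_)
open import Induction.WellFounded using (Acc; acc)
open import Relation.Binary.Definitions using (DecidableEquality)
open import Relation.Binary.PropositionalEquality using (setoid; refl; sym; trans; cong; cong₂; subst; subst₂; module ≡-Reasoning)
open import Relation.Nullary using (Dec; yes; no; ¬_; contradiction)
open import Relation.Nullary.Decidable using (_×-dec_; ¬?)
open import Relation.Unary using (Decidable)

module _ {X : Set} where

  length-filter-++ : ∀ {P : X → Set} (P? : Decidable P) xs ys →
    length (filter P? (xs ++ ys)) ≡ length (filter P? xs) + length (filter P? ys)
  length-filter-++ P? xs ys = trans (cong length (filter-++ P? xs ys)) (length-++ (filter P? xs))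

  length-filter-map : ∀ {Z : Set} {P : Z → Set} (P? : Decidable P) (g : X → Z) xs →
    length (filter P? (map g xs)) ≡ length (filter (P? ∘ g) xs)
  length-filter-map P? g [] = refl
  length-filter-map P? g (x ∷ xs) with P? (g x)
  ... | yes _ = cong suc (length-filter-map P? g xs)
  ... | no _ = length-filter-map P? g xs

  All⇒⊆-filter : ∀ {P : X → Set} (P? : Decidable P) {xs ys} → All P xs → xs ⊆ ys → xs ⊆ filter P? ys
  All⇒⊆-filter P? {xs} all xs⊆ys =
    subst (_⊆ _) (filter-all P? all) (filter⁺ P? P? (λ { refl p → p }) xs⊆ys)

  Unique-resp-⊇ : ∀ {xs ys : List X} → xs ⊆ ys → Unique ys → Unique xs
  Unique-resp-⊇ [] [] = []
  Unique-resp-⊇ (y ∷ʳ xs⊆ys) (_ ∷ u) = Unique-resp-⊇ xs⊆ys u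
  Unique-resp-⊇ (refl ∷ xs⊆ys) (y∉ys ∷ u) = All-resp-⊆ xs⊆ys y∉ys ∷ Unique-resp-⊇ xs⊆ys u

  length≤1⇒≡ : ∀ {xs} {x y : X} → length xs ≤ 1 → x ∈ xs → y ∈ xs → x ≡ y
  length≤1⇒≡ {_ ∷ []} _ (here refl) (here refl) = refl
  length≤1⇒≡ {_ ∷ _ ∷ _} (s≤s ()) _ _

  Unique⇒length≤1 : ∀ {xs : List X} → Unique xs → (∀ {x y} → x ∈ xs → y ∈ xs → x ≡ y) → length xs ≤ 1
  Unique⇒length≤1 {[]} _ _ = z≤n
  Unique⇒length≤1 {_ ∷ []} _ _ = ≤-refl
  Unique⇒length≤1 {_ ∷ _ ∷ _} ((x≢y ∷ _) ∷ _) same = contradiction (same (here refl) (there (here refl))) x≢y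

  ¬All⇒∃-split : ∀ {P : X → Set} (P? : Decidable P) {xs} → ¬ All P xs →
    ∃ λ x → ∃₂ λ ys zs → xs ≡ ys ++ x ∷ zs × ¬ P x
  ¬All⇒∃-split P? {xs} ¬all with x , x∈xs , ¬px ← find (¬All⇒Any¬ P? xs ¬all)
    with ys , zs , eq ← ∈-∃++ x∈xs = x , ys , zs , eq , ¬px

  minOver-attained : ∀ (g : X → ℕ) x xs → Any (λ y → minOver g (x ∷ xs) ≡ g y) (x ∷ xs)
  minOver-attained g x [] = here refl
  minOver-attained g x (y ∷ xs) with ⊓-sel (g y) (minOver g (x ∷ xs)) | minOver-attained g x xs
  ... | inj₁ eq | _ = there (here eq)
  ... | inj₂ eq | here eq′ = here (trans eq eq′)
  ... | inj₂ eq | there at = there (there (Any.map (trans eq) at))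

  minOver-preserves : ∀ (Q : ℕ → Set) (g : X → ℕ) {xs} → xs ≢ [] → All (Q ∘ g) xs → Q (minOver g xs)
  minOver-preserves Q g {[]} xs≢[] _ = contradiction refl xs≢[]
  minOver-preserves Q g {x ∷ xs} _ all =
    let q , eq = All.lookupAny all (minOver-attained g x xs) in subst Q (sym eq) q

  maxOver-least : ∀ {g : X → ℕ} {m} xs → All (λ x → g x ≤ m) xs → maxOver g xs ≤ m
  maxOver-least [] [] = z≤n
  maxOver-least (x ∷ xs) (gx≤m ∷ all) = ⊔-lub gx≤m (maxOver-least xs all)

m+n≤o+p∧o<m⇒n<p : ∀ {m n o p} → m + n ≤ o + p → o < m → n < p
m+n≤o+p∧o<m⇒n<p {m} {n} {o} {p} m+n≤o+p o<m = +-cancelˡ-< o n p (<-≤-trans (+-monoˡ-< n o<m) m+n≤o+p)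

m<n*o⇒0<o : ∀ {m} n o → m < n * o → 0 < o
m<n*o⇒0<o {m} n zero m<n*0 = contradiction (subst (m <_) (*-zeroʳ n) m<n*0) n≮0
m<n*o⇒0<o n (suc o) _ = z<s

0<length⇒≢[] : ∀ {X : Set} {xs : List X} → 0 < length xs → xs ≢ []
0<length⇒≢[] pos refl = n≮0 pos

≢[]⇒0<length : ∀ {X : Set} {xs : List X} → xs ≢ [] → 0 < length xs
≢[]⇒0<length {xs = []} xs≢[] = contradiction refl xs≢[]
≢[]⇒0<length {xs = _ ∷ _} _ = z<s

adversary-arithmetic : ∀ E N M u v x y → 0 < N → 0 < M → E * M ≤ 2 * N * M * u → E * N ≤ 2 * N * M * v →
  x ≤ 1 → y ≤ 1 → E * E * (x * y) ≤ 4 * (N * M) * (u * v)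
adversary-arithmetic E N M u v x y N>0 M>0 EM≤ EN≤ x≤1 y≤1 = begin
  E * E * (x * y) ≤⟨ *-monoʳ-≤ (E * E) (*-mono-≤ x≤1 y≤1) ⟩
  E * E * 1       ≡⟨ *-identityʳ (E * E) ⟩
  E * E           ≤⟨ *-cancelˡ-≤ (N * M) {{m*n≢0 N M {{>-nonZero N>0}} {{>-nonZero M>0}}}} square ⟩
  4 * (N * M) * (u * v) ∎
  where
    open ≤-Reasoning
    regroup-square : ∀ E N M → N * M * (E * E) ≡ (E * M) * (E * N)
    regroup-square = solve-∀
    regroup-bounds : ∀ N M u v → (2 * N * M * u) * (2 * N * M * v) ≡ N * M * (4 * (N * M) * (u * v))
    regroup-bounds = solve-∀
    square : N * M * (E * E) ≤ N * M * (4 * (N * M) * (u * v))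
    square = begin
      N * M * (E * E)                 ≡⟨ regroup-square E N M ⟩
      (E * M) * (E * N)               ≤⟨ *-mono-≤ EM≤ EN≤ ⟩
      (2 * N * M * u) * (2 * N * M * v) ≡⟨ regroup-bounds N M u v ⟩
      N * M * (4 * (N * M) * (u * v)) ∎

module BipartiteGraph {X Y : Set} {_~_ : X → Y → Set} (_~?_ : ∀ x y → Dec (x ~ y)) where

  isEdge? : Decidable (λ (p : X × Y) → proj₁ p ~ proj₂ p)
  isEdge? p = proj₁ p ~? proj₂ p

  edgeList : List X → List Y → List (X × Y)
  edgeList A B = filter isEdge? (cartesianProduct A B)

  edges : List X → List Y → ℕ
  edges A B = length (edgeList A B)

  degˡ : X → List Y → ℕ
  degˡ x B = length (filter (x ~?_) B)

  degʳ : List X → Y → ℕ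
  degʳ A y = length (filter (_~? y) A)

  edges-∷ˡ : ∀ x A B → edges (x ∷ A) B ≡ degˡ x B + edges A B
  edges-∷ˡ x A B = trans (length-filter-++ isEdge? (map (x ,_) B) _)
                         (cong (_+ edges A B) (length-filter-map isEdge? (x ,_) B))

  edges-[]ʳ : ∀ A y → edges A [ y ] ≡ degʳ A y
  edges-[]ʳ [] y = refl
  edges-[]ʳ (x ∷ A) y with x ~? y
  ... | yes _ = cong suc (edges-[]ʳ A y)
  ... | no _ = edges-[]ʳ A y

  edges-++ˡ : ∀ A₁ A₂ B → edges (A₁ ++ A₂) B ≡ edges A₁ B + edges A₂ B
  edges-++ˡ A₁ A₂ B = trans (cong (length ∘ filter isEdge?) (cartesianProductWith-distribʳ-++ _,_ A₁ A₂ B))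
                            (length-filter-++ isEdge? (cartesianProduct A₁ B) (cartesianProduct A₂ B))

  edges-++ʳ : ∀ A B₁ B₂ → edges A (B₁ ++ B₂) ≡ edges A B₁ + edges A B₂
  edges-++ʳ [] B₁ B₂ = refl
  edges-++ʳ (x ∷ A) B₁ B₂ = begin
    edges (x ∷ A) (B₁ ++ B₂)                             ≡⟨ edges-∷ˡ x A (B₁ ++ B₂) ⟩
    degˡ x (B₁ ++ B₂) + edges A (B₁ ++ B₂)               ≡⟨ cong₂ _+_ (length-filter-++ (x ~?_) B₁ B₂) (edges-++ʳ A B₁ B₂) ⟩
    (degˡ x B₁ + degˡ x B₂) + (edges A B₁ + edges A B₂) ≡⟨ interchange (degˡ x B₁) (degˡ x B₂) (edges A B₁) (edges A B₂) ⟩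
    (degˡ x B₁ + edges A B₁) + (degˡ x B₂ + edges A B₂) ≡⟨ sym (cong₂ _+_ (edges-∷ˡ x A B₁) (edges-∷ˡ x A B₂)) ⟩
    edges (x ∷ A) B₁ + edges (x ∷ A) B₂                 ∎
    where open ≡-Reasoning

  edges-removeˡ : ∀ A₁ x A₂ B → edges (A₁ ++ x ∷ A₂) B ≡ degˡ x B + edges (A₁ ++ A₂) B
  edges-removeˡ A₁ x A₂ B = begin
    edges (A₁ ++ x ∷ A₂) B                ≡⟨ edges-++ˡ A₁ (x ∷ A₂) B ⟩
    edges A₁ B + edges (x ∷ A₂) B         ≡⟨ cong (edges A₁ B +_) (edges-∷ˡ x A₂ B) ⟩
    edges A₁ B + (degˡ x B + edges A₂ B)  ≡⟨ x∙yz≈y∙xz (edges A₁ B) (degˡ x B) (edges A₂ B) ⟩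
    degˡ x B + (edges A₁ B + edges A₂ B)  ≡⟨ cong (degˡ x B +_) (edges-++ˡ A₁ A₂ B) ⟨
    degˡ x B + edges (A₁ ++ A₂) B         ∎
    where open ≡-Reasoning

  edges-removeʳ : ∀ A B₁ y B₂ → edges A (B₁ ++ y ∷ B₂) ≡ degʳ A y + edges A (B₁ ++ B₂)
  edges-removeʳ A B₁ y B₂ = begin
    edges A (B₁ ++ y ∷ B₂)                  ≡⟨ edges-++ʳ A B₁ (y ∷ B₂) ⟩
    edges A B₁ + edges A (y ∷ B₂)           ≡⟨ cong (edges A B₁ +_) (edges-++ʳ A [ y ] B₂) ⟩
    edges A B₁ + (edges A [ y ] + edges A B₂) ≡⟨ cong (λ d → edges A B₁ + (d + edges A B₂)) (edges-[]ʳ A y) ⟩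
    edges A B₁ + (degʳ A y + edges A B₂)    ≡⟨ x∙yz≈y∙xz (edges A B₁) (degʳ A y) (edges A B₂) ⟩
    degʳ A y + (edges A B₁ + edges A B₂)    ≡⟨ cong (degʳ A y +_) (edges-++ʳ A B₁ B₂) ⟨
    degʳ A y + edges A (B₁ ++ B₂)           ∎
    where open ≡-Reasoning

  module Peeling (α β γ : ℕ) where

    Dense : List X → List Y → Set
    Dense A B = α * length A + β * length B ≤ γ * edges A B

    record Core (A : List X) (B : List Y) : Set where
      field
        A′ : List X
        B′ : List Y
        A′⊆A : A′ ⊆ A
        B′⊆B : B′ ⊆ B
        highˡ : All (λ x → α ≤ γ * degˡ x B′) A′
        highʳ : All (λ y → β ≤ γ * degʳ A′ y) B′
        edges>0 : 0 < edges A′ B′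

    Core-mono : ∀ {A₁ A₂ B₁ B₂} → A₁ ⊆ A₂ → B₁ ⊆ B₂ → Core A₁ B₁ → Core A₂ B₂
    Core-mono A₁⊆A₂ B₁⊆B₂ c = record
      { A′ = A′ ; B′ = B′ ; A′⊆A = ⊆-trans A′⊆A A₁⊆A₂ ; B′⊆B = ⊆-trans B′⊆B B₁⊆B₂
      ; highˡ = highˡ ; highʳ = highʳ ; edges>0 = edges>0 }
      where open Core c

    removeˡ-strict : ∀ A₁ x A₂ B → Dense (A₁ ++ x ∷ A₂) B → γ * degˡ x B < α →
      α * length (A₁ ++ A₂) + β * length B < γ * edges (A₁ ++ A₂) B
    removeˡ-strict A₁ x A₂ B dense sparse = m+n≤o+p∧o<m⇒n<p (subst₂ _≤_ lhs rhs dense) sparse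
      where
        lhs : α * length (A₁ ++ x ∷ A₂) + β * length B ≡ α + (α * length (A₁ ++ A₂) + β * length B)
        lhs = trans (cong (λ l → α * l + β * length B) (length-++-sucʳ A₁ x A₂))
                    (trans (cong (_+ β * length B) (*-suc α _)) (+-assoc α _ _))
        rhs : γ * edges (A₁ ++ x ∷ A₂) B ≡ γ * degˡ x B + γ * edges (A₁ ++ A₂) B
        rhs = trans (cong (γ *_) (edges-removeˡ A₁ x A₂ B)) (*-distribˡ-+ γ _ _)

    removeʳ-strict : ∀ A B₁ y B₂ → Dense A (B₁ ++ y ∷ B₂) → γ * degʳ A y < β →
      α * length A + β * length (B₁ ++ B₂) < γ * edges A (B₁ ++ B₂)
    removeʳ-strict A B₁ y B₂ dense sparse = m+n≤o+p∧o<m⇒n<p (subst₂ _≤_ lhs rhs dense) sparse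
      where
        lhs : α * length A + β * length (B₁ ++ y ∷ B₂) ≡ β + (α * length A + β * length (B₁ ++ B₂))
        lhs = trans (cong (λ l → α * length A + β * l) (length-++-sucʳ B₁ y B₂))
                    (trans (cong (α * length A +_) (*-suc β _)) (x∙yz≈y∙xz (α * length A) β _))
        rhs : γ * edges A (B₁ ++ y ∷ B₂) ≡ γ * degʳ A y + γ * edges A (B₁ ++ B₂)
        rhs = trans (cong (γ *_) (edges-removeʳ A B₁ y B₂)) (*-distribˡ-+ γ _ _)

    peel : ∀ A B → Acc _<_ (length A + length B) → Dense A B → 0 < edges A B → Core A B
    peel A B (acc smaller) dense pos with all? (λ x → α ≤? γ * degˡ x B) A | all? (λ y → β ≤? γ * degʳ A y) B
    ... | yes highˡ | yes highʳ = record
      { A′ = A ; B′ = B ; A′⊆A = ⊆-refl ; B′⊆B = ⊆-refl ; highˡ = highˡ ; highʳ = highʳ ; edges>0 = pos }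
    ... | no ¬highˡ | _ with x , A₁ , A₂ , refl , x-sparse ← ¬All⇒∃-split (λ x → α ≤? γ * degˡ x B) ¬highˡ =
      Core-mono (++⁺ ⊆-refl (x ∷ʳ ⊆-refl)) ⊆-refl
        (peel (A₁ ++ A₂) B (smaller shorter) (<⇒≤ strict) (m<n*o⇒0<o γ _ strict))
      where
        strict = removeˡ-strict A₁ x A₂ B dense (≰⇒> x-sparse)
        shorter : length (A₁ ++ A₂) + length B < length (A₁ ++ x ∷ A₂) + length B
        shorter = +-monoˡ-< (length B) (≤-reflexive (sym (length-++-sucʳ A₁ x A₂)))
    ... | yes _ | no ¬highʳ with y , B₁ , B₂ , refl , y-sparse ← ¬All⇒∃-split (λ y → β ≤? γ * degʳ A y) ¬highʳ =
      Core-mono ⊆-refl (++⁺ ⊆-refl (y ∷ʳ ⊆-refl))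
        (peel A (B₁ ++ B₂) (smaller shorter) (<⇒≤ strict) (m<n*o⇒0<o γ _ strict))
      where
        strict = removeʳ-strict A B₁ y B₂ dense (≰⇒> y-sparse)
        shorter : length A + length (B₁ ++ B₂) < length A + length (B₁ ++ y ∷ B₂)
        shorter = +-monoʳ-< (length A) (≤-reflexive (sym (length-++-sucʳ B₁ y B₂)))

    dense⇒core : ∀ A B → Dense A B → 0 < edges A B → Core A B
    dense⇒core A B = peel A B (<-wellFounded _)

  edgeList-unique : ∀ {A B} → Unique A → Unique B → Unique (edgeList A B)
  edgeList-unique uA uB = Unique.filter⁺ isEdge? (Unique.cartesianProduct⁺ uA uB)

  edgeList-all : ∀ {P : X → Set} {Q : Y → Set} {A B} → All P A → All Q B →
    All (λ p → P (proj₁ p) × Q (proj₂ p)) (edgeList A B)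
  edgeList-all {A = A} {B} pA qB = Allₚ.filter⁺ isEdge?
    (Allₚ.cartesianProduct⁺ (setoid X) (setoid Y) A B λ x∈A y∈B → All.lookup pA x∈A , All.lookup qB y∈B)

  edgeList-edges : ∀ A B → All (λ p → proj₁ p ~ proj₂ p) (edgeList A B)
  edgeList-edges A B = all-filter isEdge? (cartesianProduct A B)

  row-⊆ : ∀ {x : X} {A} (B : List Y) → x ∈ A → map (x ,_) B ⊆ cartesianProduct A B
  row-⊆ B (here refl) = ++⁺ʳ _ ⊆-refl
  row-⊆ B (there x∈A) = ++⁺ˡ _ (row-⊆ B x∈A)

  column-⊆ : ∀ {y : Y} {B} (A : List X) → y ∈ B → map (_, y) A ⊆ cartesianProduct A B
  column-⊆ [] y∈B = []
  column-⊆ (x ∷ A) y∈B = ++⁺ (map⁺ (x ,_) (from∈ y∈B)) (column-⊆ A y∈B)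

  module _ (_≟ˣ_ : DecidableEquality X) where

    degˡ≤|R[x,-]| : ∀ {x : X} {A} (B : List Y) → x ∈ A → degˡ x B ≤ length (filter (λ p → proj₁ p ≟ˣ x) (edgeList A B))
    degˡ≤|R[x,-]| {x} {A} B x∈A = begin
      degˡ x B                                          ≡⟨ length-map (x ,_) (filter (x ~?_) B) ⟨
      length (map (x ,_) (filter (x ~?_) B))            ≤⟨ length-mono-≤ (All⇒⊆-filter _ onRow (All⇒⊆-filter isEdge? adjacent neighbours⊆)) ⟩
      length (filter (λ p → proj₁ p ≟ˣ x) (edgeList A B)) ∎
      where
        open ≤-Reasoning
        neighbours⊆ : map (x ,_) (filter (x ~?_) B) ⊆ cartesianProduct A B
        neighbours⊆ = ⊆-trans (map⁺ (x ,_) (filter-⊆ (x ~?_) B)) (row-⊆ B x∈A)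
        adjacent : All (λ p → proj₁ p ~ proj₂ p) (map (x ,_) (filter (x ~?_) B))
        adjacent = Allₚ.map⁺ (all-filter (x ~?_) B)
        onRow : All (λ p → proj₁ p ≡ x) (map (x ,_) (filter (x ~?_) B))
        onRow = Allₚ.map⁺ (All.tabulate λ _ → refl)

  module _ (_≟ʸ_ : DecidableEquality Y) where

    degʳ≤|R[-,y]| : ∀ {y : Y} {B} (A : List X) → y ∈ B → degʳ A y ≤ length (filter (λ p → proj₂ p ≟ʸ y) (edgeList A B))
    degʳ≤|R[-,y]| {y} {B} A y∈B = begin
      degʳ A y                                          ≡⟨ length-map (_, y) (filter (_~? y) A) ⟨
      length (map (_, y) (filter (_~? y) A))            ≤⟨ length-mono-≤ (All⇒⊆-filter _ onColumn (All⇒⊆-filter isEdge? adjacent neighbours⊆)) ⟩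
      length (filter (λ p → proj₂ p ≟ʸ y) (edgeList A B)) ∎
      where
        open ≤-Reasoning
        neighbours⊆ : map (_, y) (filter (_~? y) A) ⊆ cartesianProduct A B
        neighbours⊆ = ⊆-trans (map⁺ (_, y) (filter-⊆ (_~? y) A)) (column-⊆ A y∈B)
        adjacent : All (λ p → proj₁ p ~ proj₂ p) (map (_, y) (filter (_~? y) A))
        adjacent = Allₚ.map⁺ (all-filter (_~? y) A)
        onColumn : All (λ p → proj₂ p ≡ y) (map (_, y) (filter (_~? y) A))
        onColumn = Allₚ.map⁺ (All.tabulate λ _ → refl)

  ∈-edgeList⁻ : ∀ {A B p} → p ∈ edgeList A B → proj₁ p ∈ A × proj₂ p ∈ B
  ∈-edgeList⁻ {A} {B} p∈R = ∈-cartesianProduct⁻ A B (proj₁ (∈-filter⁻ isEdge? p∈R))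

record OnlyDifferAt {n} (i : Fin n) (x y : Point n) : Set where
  constructor _,_
  field
    differ : lookup x i ≢ lookup y i
    agree : ∀ j → j ≢ i → lookup x j ≡ lookup y j

module _ {n : ℕ} {i : Fin n} where

  OnlyDifferAt-sym : ∀ {x y} → OnlyDifferAt i x y → OnlyDifferAt i y x
  OnlyDifferAt-sym (xᵢ≢yᵢ , agree) = xᵢ≢yᵢ ∘ sym , λ j j≢i → sym (agree j j≢i)

  OnlyDifferAt-unique : ∀ {x y z} → OnlyDifferAt i x y → OnlyDifferAt i x z → y ≡ z
  OnlyDifferAt-unique {x} {y} {z} (xᵢ≢yᵢ , agreeʸ) (xᵢ≢zᵢ , agreeᶻ) = Pointwise-≡⇒≡ (ext same)
    where
      same : ∀ j → lookup y j ≡ lookup z j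
      same j with j ≟ᶠ i
      ... | yes refl = trans (¬-not (xᵢ≢yᵢ ∘ sym)) (sym (¬-not (xᵢ≢zᵢ ∘ sym)))
      ... | no j≢i = trans (sym (agreeʸ j j≢i)) (agreeᶻ j j≢i)

  adjacent⇒OnlyDifferAt : ∀ x y → hamming x y ≡ 1 → lookup x i ≢ lookup y i → OnlyDifferAt i x y
  adjacent⇒OnlyDifferAt x y h≡1 xᵢ≢yᵢ = xᵢ≢yᵢ , agree
    where
      differs : ∀ {k} → lookup x k ≢ lookup y k → k ∈ filter (λ k → ¬? (lookup x k ≟ᵇ lookup y k)) (allFin n)
      differs {k} = ∈-filter⁺ (λ k → ¬? (lookup x k ≟ᵇ lookup y k)) (∈-allFin k)
      agree : ∀ j → j ≢ i → lookup x j ≡ lookup y j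
      agree j j≢i with lookup x j ≟ᵇ lookup y j
      ... | yes xⱼ≡yⱼ = xⱼ≡yⱼ
      ... | no xⱼ≢yⱼ = contradiction (length≤1⇒≡ (≤-reflexive h≡1) (differs xⱼ≢yⱼ) (differs xᵢ≢yᵢ)) j≢i

module _ {n : ℕ} {R : Rel n} (R-unique : Unique R) (R-adjacent : All (λ p → hamming (proj₁ p) (proj₂ p) ≡ 1) R) where

  degLᵢ≤1 : ∀ a i → degLᵢ R a i ≤ 1
  degLᵢ≤1 a i = Unique⇒length≤1 (Unique.filter⁺ R[a,-]ᵢ? R-unique) same
    where
      R[a,-]ᵢ? = λ (p : Point n × Point n) → (proj₁ p ≟ₚ a) ×-dec ¬? (lookup (proj₁ p) i ≟ᵇ lookup (proj₂ p) i)
      same : ∀ {p q} → p ∈ filter R[a,-]ᵢ? R → q ∈ filter R[a,-]ᵢ? R → p ≡ q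
      same {_ , y} {_ , z} p∈ q∈ with ∈-filter⁻ R[a,-]ᵢ? p∈ | ∈-filter⁻ R[a,-]ᵢ? q∈
      ... | p∈R , refl , aᵢ≢yᵢ | q∈R , refl , aᵢ≢zᵢ = cong (a ,_) (OnlyDifferAt-unique
            (adjacent⇒OnlyDifferAt a y (All.lookup R-adjacent p∈R) aᵢ≢yᵢ)
            (adjacent⇒OnlyDifferAt a z (All.lookup R-adjacent q∈R) aᵢ≢zᵢ))

  degRᵢ≤1 : ∀ b i → degRᵢ R b i ≤ 1
  degRᵢ≤1 b i = Unique⇒length≤1 (Unique.filter⁺ R[-,b]ᵢ? R-unique) same
    where
      R[-,b]ᵢ? = λ (p : Point n × Point n) → (proj₂ p ≟ₚ b) ×-dec ¬? (lookup (proj₁ p) i ≟ᵇ lookup (proj₂ p) i)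
      same : ∀ {p q} → p ∈ filter R[-,b]ᵢ? R → q ∈ filter R[-,b]ᵢ? R → p ≡ q
      same {x , _} {z , _} p∈ q∈ with ∈-filter⁻ R[-,b]ᵢ? p∈ | ∈-filter⁻ R[-,b]ᵢ? q∈
      ... | p∈R , refl , xᵢ≢bᵢ | q∈R , refl , zᵢ≢bᵢ = cong (_, b) (OnlyDifferAt-unique
            (OnlyDifferAt-sym (adjacent⇒OnlyDifferAt x b (All.lookup R-adjacent p∈R) xᵢ≢bᵢ))
            (OnlyDifferAt-sym (adjacent⇒OnlyDifferAt z b (All.lookup R-adjacent q∈R) zᵢ≢bᵢ)))

  maxDegLᵢ≤1 : maxDegLᵢ R ≤ 1
  maxDegLᵢ≤1 = maxOver-least R (All.tabulate λ {p} _ → maxOver-least (allFin n) (All.tabulate λ {i} _ → degLᵢ≤1 (proj₁ p) i))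

  maxDegRᵢ≤1 : maxDegRᵢ R ≤ 1
  maxDegRᵢ≤1 = maxOver-least R (All.tabulate λ {p} _ → maxOver-least (allFin n) (All.tabulate λ {i} _ → degRᵢ≤1 (proj₂ p) i))

module _ {n : ℕ} where
  open BipartiteGraph (adjacent? {n})

  minDegL-bound : ∀ {α} γ A B → edgeList A B ≢ [] → All (λ x → α ≤ γ * degˡ x B) A → α ≤ γ * minDegL (edgeList A B)
  minDegL-bound {α} γ A B R≢[] high = minOver-preserves (λ d → α ≤ γ * d) _ R≢[] (All.tabulate bound)
    where
      bound : ∀ {p} → p ∈ edgeList A B → α ≤ γ * degL (edgeList A B) (proj₁ p)
      bound p∈R = let x∈A = proj₁ (∈-edgeList⁻ {A} {B} p∈R) in
        ≤-trans (All.lookup high x∈A) (*-monoʳ-≤ γ (degˡ≤|R[x,-]| _≟ₚ_ B x∈A))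

  minDegR-bound : ∀ {β} γ A B → edgeList A B ≢ [] → All (λ y → β ≤ γ * degʳ A y) B → β ≤ γ * minDegR (edgeList A B)
  minDegR-bound {β} γ A B R≢[] high = minOver-preserves (λ d → β ≤ γ * d) _ R≢[] (All.tabulate bound)
    where
      bound : ∀ {p} → p ∈ edgeList A B → β ≤ γ * degR (edgeList A B) (proj₂ p)
      bound p∈R = let y∈B = proj₂ (∈-edgeList⁻ {A} {B} p∈R) in
        ≤-trans (All.lookup high y∈B) (*-monoʳ-≤ γ (degʳ≤|R[-,y]| _≟ₚ_ A y∈B))

AdversaryWitness : ∀ {n} → (Point n → Bool) → List (Point n) → List (Point n) → Set
AdversaryWitness {n} f A B = Σ (Rel n) λ R → Unique R × All (λ p → f (proj₁ p) ≡ true × f (proj₂ p) ≡ false) R × R ≢ [] ×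
  (edgeCount A B * edgeCount A B) * (maxDegLᵢ R * maxDegRᵢ R) ≤ 4 * (length A * length B) * (minDegL R * minDegR R)

module _ {n : ℕ} (f : Point n → Bool) where
  open BipartiteGraph (adjacent? {n})

  edgeless-witness : ∀ {A B} → All (λ a → f a ≡ true) A → All (λ b → f b ≡ false) B → A ≢ [] → B ≢ [] →
    edgeCount A B ≡ 0 → AdversaryWitness f A B
  edgeless-witness {[]} _ _ A≢[] _ _ = contradiction refl A≢[]
  edgeless-witness {_ ∷ _} {[]} _ _ _ B≢[] _ = contradiction refl B≢[]
  edgeless-witness {a ∷ A} {b ∷ B} (fa ∷ _) (fb ∷ _) _ _ E≡0 =
    [ (a , b) ] , [] ∷ [] , (fa , fb) ∷ [] , (λ ()) , subst (λ E → E * E * _ ≤ 4 * (length (a ∷ A) * length (b ∷ B)) * _) (sym E≡0) z≤n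

  dense-witness : ∀ {A B} → Unique A → Unique B → All (λ a → f a ≡ true) A → All (λ b → f b ≡ false) B →
    A ≢ [] → B ≢ [] → 0 < edgeCount A B → AdversaryWitness f A B
  dense-witness {A} {B} uA uB tA fB A≢[] B≢[] E>0 =
    R , R-unique , edgeList-all {A = A′} {B′} (All-resp-⊆ A′⊆A tA) (All-resp-⊆ B′⊆B fB) , R≢[] ,
    adversary-arithmetic E N M (minDegL R) (minDegR R) (maxDegLᵢ R) (maxDegRᵢ R) (≢[]⇒0<length A≢[]) (≢[]⇒0<length B≢[])
      (minDegL-bound γ A′ B′ R≢[] highˡ) (minDegR-bound γ A′ B′ R≢[] highʳ)
      (maxDegLᵢ≤1 R-unique R-adjacent) (maxDegRᵢ≤1 R-unique R-adjacent)
    where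
      E = edgeCount A B
      N = length A
      M = length B
      γ = 2 * N * M
      open Peeling (E * M) (E * N) γ
      double-count : ∀ E N M → E * M * N + E * N * M ≡ 2 * N * M * E
      double-count = solve-∀
      open Core (dense⇒core A B (≤-reflexive (double-count E N M)) E>0)
      R = edgeList A′ B′
      R-unique = edgeList-unique (Unique-resp-⊇ A′⊆A uA) (Unique-resp-⊇ B′⊆B uB)
      R-adjacent = edgeList-edges A′ B′
      R≢[] = 0<length⇒≢[] edges>0

proposition6p9 : (n : ℕ) (f : Point n → Bool)
    (A B : List (Point n)) → Unique A → Unique B →
    All (λ a → f a ≡ true) A → All (λ b → f b ≡ false) B →
    A ≢ [] → B ≢ [] →
    Σ (Rel n) λ R → Unique R × All (λ p → f (proj₁ p) ≡ true × f (proj₂ p) ≡ false) R × R ≢ [] ×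
      (edgeCount A B * edgeCount A B) * (maxDegLᵢ R * maxDegRᵢ R)
        ≤ 4 * (length A * length B) * (minDegL R * minDegR R)
proposition6p9 n f A B uA uB tA fB A≢[] B≢[] with 0 <? edgeCount A B
... | yes E>0 = dense-witness f uA uB tA fB A≢[] B≢[] E>0
... | no E≯0 = edgeless-witness f tA fB A≢[] B≢[] (n≤0⇒n≡0 (≮⇒≥ E≯0))
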